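{- For each set $P$ of prime numbers, there is a set $A \subseteq \mathbb{N}$ such that, for every prime $p$, the ratio set $R(A) = \{a/a' : a,a' \in A\}$ is dense in $\mathbb{Q}_p$ if and only if $p \in P$.
   Context: $\mathbb{N} = \{1,2,\ldots\}$; $\mathbb{Q}_p$ denotes the field of $p$-adic numbers with the $p$-adic metric. -}

module Defs where

open import Level using (0ℓ)
open import Data.Nat using (ℕ; NonZero; _^_)
open import Data.Integer using (ℤ; +_)
open import Data.Integer.Divisibility using (_∣_)
open import Data.Rational using (ℚ; _/_; _-_; ↥_)
open import Data.Product using (Σ; ∃; _×_)
open import Relation.Binary.PropositionalEquality using (_≡_)

-- |r|_p ≤ p^(-k) for a rational r.  Since ℚ values are in lowest terms,
-- for k ≥ 1 this is exactly p^k ∣ numerator (the denominator is then prime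
-- to p); for k = 0 the condition is trivially true (imprecise there),
-- but k = 0 is irrelevant for density.  r = 0 satisfies it for all k.
PAdicSmall : ℕ → ℕ → ℚ → Set
PAdicSmall p k r = (+ (p ^ k)) ∣ (↥ r)

-- S ⊆ ℚ is dense in ℚ_p.  Since ℚ is dense in ℚ_p, this is equivalent to:
-- every rational x and every radius p^(-k) has a point of S within p^(-k).
DenseInQp : ℕ → (ℚ → Set) → Set
DenseInQp p S = ∀ (x : ℚ) (k : ℕ) → Σ ℚ λ s → S s × PAdicSmall p k (s - x)

RatioSet : (ℕ → Set) → ℚ → Set
RatioSet A q = Σ ℕ λ a → Σ ℕ λ a' → A a × A a' ×
  Σ (NonZero a') λ nz → q ≡ ((+ a) / a') {{nz}}

-- A[P] consists of the numbers q^j·b with q ∈ P whose cofactor b satisfies b ≡ 1 (mod M) and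
-- b ≤ h·M for some h, where M is the product of the integers in [1, h] not divisible by q.
-- For p ∈ P and x = n/(p^e·d₀) with p ∤ d₀, take h = p^(k+e) and b = 1 + M·y with
-- M·d₀·y ≡ n − d₀ (mod p^(k+e)); then d₀·b ≡ n, so b/p^e ∈ R(A) lies within p^(−k) of x.
-- For a prime p ∉ P, every element of A has p-adic valuation below p: if p ≤ h then p divides M,
-- hence b − 1, so p ∤ b; if h < p then b ≤ h^(h+1) < p^p. So no ratio lies within p^(−p) of 0.

module Submission where

open import Defs
open import Data.Nat using (ℕ; NonZero)
open import Data.Nat.Primality using (Prime)
open import Data.Product using (Σ; _×_; _,_)
open import Function.Bundles using (_⇔_; mk⇔)

module PrimePowers where
  open import Data.Nat using (zero; suc; _*_; _^_; _<_; nonTrivial⇒n>1)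
  open import Data.Nat.Properties using (<⇒≢; <-irrefl; *-identityˡ; *-comm; *-assoc; m<m*n; m*n≢0⇒m≢0)
  open import Data.Nat.Divisibility using (_∣_; _∣?_; divides-refl; ∣-trans; ∣1⇒≡1; m∣m*n)
  open import Data.Nat.Coprimality as Coprime using (Coprime; coprime-divisor)
  open import Data.Nat.Induction using (<-wellFounded)
  open import Data.Nat.Primality using (prime⇒nonTrivial; prime⇒irreducible; euclidsLemma)
  open import Data.Product using (∃₂)
  open import Data.Sum using (inj₁; inj₂; [_,_]′)
  open import Function using (_∘_)
  open import Induction.WellFounded using (Acc; acc)
  open import Relation.Nullary using (¬_; yes; no; contradiction)
  open import Relation.Binary.PropositionalEquality using (_≡_; refl; sym; trans)

  private variable
    p q m : ℕ

  prime>1 : Prime p → 1 < p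
  prime>1 {p} p-prime = nonTrivial⇒n>1 p {{prime⇒nonTrivial p-prime}}

  prime∤1 : Prime p → ¬ p ∣ 1
  prime∤1 p-prime p∣1 = <⇒≢ (prime>1 p-prime) (sym (∣1⇒≡1 p∣1))

  prime∣prime⇒≡ : Prime p → Prime q → p ∣ q → p ≡ q
  prime∣prime⇒≡ p-prime q-prime p∣q with prime⇒irreducible q-prime p∣q
  ... | inj₁ refl = contradiction (prime>1 p-prime) (<-irrefl refl)
  ... | inj₂ p≡q  = p≡q

  prime∤⇒coprime : Prime p → ¬ p ∣ m → Coprime p m
  prime∤⇒coprime p-prime p∤m (d∣p , d∣m) with prime⇒irreducible p-prime d∣p
  ... | inj₁ d≡1  = d≡1
  ... | inj₂ refl = contradiction d∣m p∤m

  prime^-coprime : Prime p → ¬ p ∣ m → ∀ k → Coprime (p ^ k) m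
  prime^-coprime p-prime p∤m zero    (d∣1 , _) = ∣1⇒≡1 d∣1
  prime^-coprime {p} p-prime p∤m (suc k) {d} (d∣p^[1+k] , d∣m) with p ∣? d
  ... | yes p∣d = contradiction (∣-trans p∣d d∣m) p∤m
  ... | no  p∤d = prime^-coprime p-prime p∤m k
                    (coprime-divisor (Coprime.sym (prime∤⇒coprime p-prime p∤d)) d∣p^[1+k] , d∣m)

  prime∤^ : Prime p → ¬ p ∣ m → ∀ j → ¬ p ∣ m ^ j
  prime∤^ p-prime p∤m zero    = prime∤1 p-prime
  prime∤^ {m = m} p-prime p∤m (suc j) =
    [ p∤m , prime∤^ p-prime p∤m j ]′ ∘ euclidsLemma m (m ^ j) p-prime

  m∣m^n : ∀ m n → .{{NonZero n}} → m ∣ m ^ n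
  m∣m^n m (suc n) = m∣m*n (m ^ n)

  prime-power-split : Prime p → ∀ d → .{{NonZero d}} → ∃₂ λ e d₀ → d ≡ p ^ e * d₀ × ¬ p ∣ d₀
  prime-power-split {p} p-prime d = split d (<-wellFounded d)
    where
    split : ∀ d → .{{NonZero d}} → Acc _<_ d → ∃₂ λ e d₀ → d ≡ p ^ e * d₀ × ¬ p ∣ d₀
    split d (acc smaller) with p ∣? d
    ... | no  p∤d = 0 , d , sym (*-identityˡ d) , p∤d
    ... | yes (divides-refl c) with split c {{c≢0}} (smaller (m<m*n c p {{c≢0}} (prime>1 p-prime)))
      where c≢0 = m*n≢0⇒m≢0 c
    ... | e , d₀ , refl , p∤d₀ = suc e , d₀ , rotate (p ^ e) d₀ p , p∤d₀
      where
      rotate : ∀ a b c → a * b * c ≡ c * a * b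
      rotate a b c = trans (*-comm (a * b) c) (sym (*-assoc c a b))

module AvoidingFactorials where
  open PrimePowers using (prime∤1)
  open import Data.Nat using (zero; suc; _*_; _^_; _≤_; _<_; z<s)
  open import Data.Nat.Properties
    using (≤-refl; ≤-trans; ≤-pred; n≤1+n; m≤n⇒m<n∨m≡n; m≤n*m; *-monoʳ-≤; ^-monoˡ-≤; m*n≢0)
  open import Data.Nat.Divisibility using (_∣_; _∣?_; m∣m*n; ∣n⇒∣m*n)
  open import Data.Nat.Primality using (euclidsLemma)
  open import Data.Sum using (inj₁; inj₂; [_,_]′)
  open import Function using (_∘_)
  open import Relation.Nullary using (¬_; yes; no; contradiction)
  open import Relation.Binary.PropositionalEquality using (refl)

  private variable
    p q h i : ℕ

  factorialAvoiding : ℕ → ℕ → ℕ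
  factorialAvoiding q zero = 1
  factorialAvoiding q (suc h) with q ∣? suc h
  ... | yes _ = factorialAvoiding q h
  ... | no  _ = suc h * factorialAvoiding q h

  factorialAvoiding≢0 : ∀ q h → NonZero (factorialAvoiding q h)
  factorialAvoiding≢0 q zero = _
  factorialAvoiding≢0 q (suc h) with q ∣? suc h
  ... | yes _ = factorialAvoiding≢0 q h
  ... | no  _ = m*n≢0 (suc h) _ {{_}} {{factorialAvoiding≢0 q h}}

  ∣factorialAvoiding : 0 < i → i ≤ h → ¬ q ∣ i → i ∣ factorialAvoiding q h
  ∣factorialAvoiding {h = zero} z<s ()
  ∣factorialAvoiding {h = suc h} {q} 0<i i≤1+h q∤i with q ∣? suc h | m≤n⇒m<n∨m≡n i≤1+h
  ... | yes _   | inj₁ i<1+h = ∣factorialAvoiding 0<i (≤-pred i<1+h) q∤i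
  ... | no  _   | inj₁ i<1+h = ∣n⇒∣m*n (suc h) (∣factorialAvoiding 0<i (≤-pred i<1+h) q∤i)
  ... | yes q∣i | inj₂ refl  = contradiction q∣i q∤i
  ... | no  _   | inj₂ refl  = m∣m*n _

  factorialAvoiding-suc≤ : ∀ q h → factorialAvoiding q (suc h) ≤ suc h * factorialAvoiding q h
  factorialAvoiding-suc≤ q h with q ∣? suc h
  ... | yes _ = m≤n*m _ (suc h)
  ... | no  _ = ≤-refl

  factorialAvoiding≤^ : ∀ q h → factorialAvoiding q h ≤ h ^ h
  factorialAvoiding≤^ q zero    = ≤-refl
  factorialAvoiding≤^ q (suc h) = ≤-trans (factorialAvoiding-suc≤ q h)
    (*-monoʳ-≤ (suc h) (≤-trans (factorialAvoiding≤^ q h) (^-monoˡ-≤ h (n≤1+n h))))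

  prime∤factorialAvoiding : Prime p → ∀ h → ¬ p ∣ factorialAvoiding p h
  prime∤factorialAvoiding p-prime zero = prime∤1 p-prime
  prime∤factorialAvoiding {p} p-prime (suc h) with p ∣? suc h
  ... | yes _     = prime∤factorialAvoiding p-prime h
  ... | no  p∤1+h = [ p∤1+h , prime∤factorialAvoiding p-prime h ]′ ∘ euclidsLemma (suc h) _ p-prime

module LinearCongruences where
  open import Data.Nat as ℕ using ()
  open import Data.Nat.Coprimality using (Coprime; coprime-Bézout)
  open import Data.Nat.GCD using (module Bézout)
  open import Data.Integer using (+_; 1ℤ; _+_; _-_; _*_; -_)
  open import Data.Integer.Properties using (pos-*; neg-distribˡ-*)
  open import Data.Integer.Divisibility.Signed using (_∣_; divides; ∣-refl; ∣n⇒∣m*n; ∣m∣n⇒∣m-n)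
  open import Data.Integer.DivMod using (_%ℕ_; _/ℕ_; a≡a%ℕn+[a/ℕn]*n; n%ℕd<d)
  open import Data.Integer.Tactic.RingSolver using (solve-∀)
  open import Data.Product using (∃)
  open import Relation.Binary.PropositionalEquality using (_≡_; sym; cong; subst; module ≡-Reasoning)
  open ≡-Reasoning

  private variable
    m n : ℕ

  coprime⇒invertible : Coprime m n → ∃ λ u → + n ∣ u * + m - 1ℤ
  coprime⇒invertible {m} {n} m⊥n with coprime-Bézout m⊥n
  ... | Bézout.+- x y 1+yn≡xm = + x , divides (+ y) (begin
    + x * + m - 1ℤ         ≡⟨ cong (_- 1ℤ) (pos-* x m) ⟨
    + (x ℕ.* m) - 1ℤ       ≡⟨ cong (λ k → + k - 1ℤ) 1+yn≡xm ⟨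
    + (y ℕ.* n)            ≡⟨ pos-* y n ⟩
    + y * + n              ∎)
  ... | Bézout.-+ x y 1+xm≡yn = - + x , divides (- + y) (begin
    - + x * + m - 1ℤ       ≡⟨ negate-minus-one (+ x) (+ m) ⟩
    - (1ℤ + + x * + m)     ≡⟨ cong (λ k → - (1ℤ + k)) (pos-* x m) ⟨
    - + (1 ℕ.+ x ℕ.* m)    ≡⟨ cong (λ k → - + k) 1+xm≡yn ⟩
    - + (y ℕ.* n)          ≡⟨ cong -_ (pos-* y n) ⟩
    - (+ y * + n)          ≡⟨ neg-distribˡ-* (+ y) (+ n) ⟩
    - + y * + n            ∎)
    where
    negate-minus-one : ∀ X M → - X * M - 1ℤ ≡ - (1ℤ + X * M)
    negate-minus-one = solve-∀

  linear-congruence : ∀ n .{{_ : NonZero n}} → Coprime m n → ∀ t →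
                      ∃ λ y → y ℕ.< n × + n ∣ + m * + y - t
  linear-congruence {m} n m⊥n t with coprime⇒invertible m⊥n
  ... | u , n∣um-1 = y , n%ℕd<d (t * u) n , subst (+ n ∣_) (sym my-t≡) n∣rhs
    where
    y = (t * u) %ℕ n
    k = (t * u) /ℕ n
    n∣rhs : + n ∣ t * (u * + m - 1ℤ) - + m * k * + n
    n∣rhs = ∣m∣n⇒∣m-n (∣n⇒∣m*n t n∣um-1) (∣n⇒∣m*n (+ m * k) ∣-refl)
    my-t≡ : + m * + y - t ≡ t * (u * + m - 1ℤ) - + m * k * + n
    my-t≡ = begin
      + m * + y - t                              ≡⟨ add-and-subtract (+ m) (+ y) t k (+ n) ⟩
      + m * (+ y + k * + n) - + m * k * + n - t
        ≡⟨ cong (λ z → + m * z - + m * k * + n - t) (a≡a%ℕn+[a/ℕn]*n (t * u) n) ⟨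
      + m * (t * u) - + m * k * + n - t          ≡⟨ regroup (+ m) t u k (+ n) ⟩
      t * (u * + m - 1ℤ) - + m * k * + n         ∎
      where
      add-and-subtract : ∀ M Y T K N → M * Y - T ≡ M * (Y + K * N) - M * K * N - T
      add-and-subtract = solve-∀
      regroup : ∀ M T U K N → M * (T * U) - M * K * N - T ≡ T * (U * M - 1ℤ) - M * K * N
      regroup = solve-∀

module Numerators where
  open PrimePowers using (prime>1)
  open import Data.Nat as ℕ using (suc)
  open import Data.Nat.Properties using (<⇒≢; *-comm)
  open import Data.Nat.Divisibility as ℕ using (∣m⇒∣m*n)
  open import Data.Nat.Coprimality as Coprime using (Coprime; coprime-divisor)
  open import Data.Integer using (+_; _+_; _-_; _*_; -_; ∣_∣)
  open import Data.Integer.Properties using (pos-*; abs-*; neg-distribˡ-*; *-cancelˡ-≡)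
  open import Data.Integer.Divisibility using (_∣_)
  import Data.Integer.Divisibility.Signed as Signed
  import Data.Integer.Coprimality as ℤ
  open import Data.Integer.GCD using (gcd)
  open import Data.Integer.Tactic.RingSolver using (solve-∀)
  open import Data.Rational using (ℚ; mkℚ; ↥_; ↧_; ↧ₙ_; _/_; toℚᵘ) renaming (_-_ to _-ℚ_; -_ to -ℚ_)
  open import Data.Rational.Properties using (↥-/; ↧-/; toℚᵘ-homo-+; toℚᵘ-homo‿-)
  open import Data.Rational.Unnormalised as ℚᵘ using (ℚᵘ; *≡*; _≃_)
  open import Data.Rational.Unnormalised.Properties using (≃-trans; +-cong)
  open import Relation.Nullary using (¬_)
  open import Relation.Binary.PropositionalEquality using (_≡_; sym; trans; cong; subst; subst₂; module ≡-Reasoning)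
  open ≡-Reasoning

  private variable
    p m : ℕ
    r : ℚ
    u : ℚᵘ

  toℚᵘ-≃⇒cross : toℚᵘ r ≃ u → ↥ r * ℚᵘ.↧ u ≡ ℚᵘ.↥ u * ↧ r
  toℚᵘ-≃⇒cross {mkℚ _ _ _} (*≡* eq) = eq

  cross⇒toℚᵘ-≃ : ↥ r * ℚᵘ.↧ u ≡ ℚᵘ.↥ u * ↧ r → toℚᵘ r ≃ u
  cross⇒toℚᵘ-≃ {mkℚ _ _ _} eq = *≡* eq

  ↥[i/n]*n≡i*↧[i/n] : ∀ i n .{{_ : NonZero n}} → ↥ (i / n) * + n ≡ i * ↧ (i / n)
  ↥[i/n]*n≡i*↧[i/n] i n = begin
    ↥ (i / n) * + n                  ≡⟨ cong (↥ (i / n) *_) (↧-/ i n) ⟨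
    ↥ (i / n) * (↧ (i / n) * g)      ≡⟨ swap (↥ (i / n)) (↧ (i / n)) g ⟩
    ↥ (i / n) * g * ↧ (i / n)        ≡⟨ cong (_* ↧ (i / n)) (↥-/ i n) ⟩
    i * ↧ (i / n)                    ∎
    where
    g = gcd i (+ n)
    swap : ∀ a b c → a * (b * c) ≡ a * c * b
    swap = solve-∀

  toℚᵘ-/ : ∀ i n .{{_ : NonZero n}} → toℚᵘ (i / n) ≃ i ℚᵘ./ n
  toℚᵘ-/ i (suc n) = cross⇒toℚᵘ-≃ (↥[i/n]*n≡i*↧[i/n] i (suc n))

  ↥[i/n-x]-cross : ∀ i n .{{_ : NonZero n}} x →
                   ↥ (i / n -ℚ x) * (+ n * ↧ x) ≡ (i * ↧ x - ↥ x * + n) * ↧ (i / n -ℚ x)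
  ↥[i/n-x]-cross i (suc n) x@(mkℚ a _ _) = begin
    ↥ δ * (+ suc n * ↧ x)                   ≡⟨ toℚᵘ-≃⇒cross toℚᵘ-δ ⟩
    (i * ↧ x + (- a) * + suc n) * ↧ δ       ≡⟨ cong (λ k → (i * ↧ x + k) * ↧ δ) (neg-distribˡ-* a (+ suc n)) ⟨
    (i * ↧ x - a * + suc n) * ↧ δ           ∎
    where
    δ = i / suc n -ℚ x
    toℚᵘ-δ : toℚᵘ δ ≃ i ℚᵘ./ suc n ℚᵘ.- toℚᵘ x
    toℚᵘ-δ = ≃-trans (toℚᵘ-homo-+ (i / suc n) (-ℚ x)) (+-cong (toℚᵘ-/ i (suc n)) (toℚᵘ-homo‿- x))

  prime∣↥⇒∤↧ : Prime p → + p ∣ ↥ r → ¬ p ℕ.∣ ↧ₙ r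
  prime∣↥⇒∤↧ {r = mkℚ _ _ coprime} p-prime p∣↥r p∣↧r =
    <⇒≢ (prime>1 p-prime) (sym (Coprime.recompute coprime (p∣↥r , p∣↧r)))

  coprime∧∣↥[a/n]⇒∣a : ∀ a n .{{_ : NonZero n}} →
                       Coprime m (↧ₙ (+ a / n)) → + m ∣ ↥ (+ a / n) → m ℕ.∣ a
  coprime∧∣↥[a/n]⇒∣a {m} a n m⊥↧ m∣↥ =
    coprime-divisor m⊥↧ (subst (m ℕ.∣_) ∣↥∣*n≡↧*a (∣m⇒∣m*n n m∣↥))
    where
    s = + a / n
    ∣↥∣*n≡↧*a : ∣ ↥ s ∣ ℕ.* n ≡ ↧ₙ s ℕ.* a
    ∣↥∣*n≡↧*a = begin
      ∣ ↥ s ∣ ℕ.* n      ≡⟨ abs-* (↥ s) (+ n) ⟨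
      ∣ ↥ s * + n ∣      ≡⟨ cong ∣_∣ (↥[i/n]*n≡i*↧[i/n] (+ a) n) ⟩
      ∣ + a * ↧ s ∣      ≡⟨ abs-* (+ a) (↧ s) ⟩
      a ℕ.* ↧ₙ s         ≡⟨ *-comm a (↧ₙ s) ⟩
      ↧ₙ s ℕ.* a         ∎

  congruence⇒∣↥[b/c-x] : ∀ x b c d₀ .{{_ : NonZero c}} → ↧ₙ x ≡ c ℕ.* d₀ → Coprime m d₀ →
                         + (m ℕ.* c) Signed.∣ + d₀ * + b - ↥ x → + m ∣ ↥ (+ b / c -ℚ x)
  congruence⇒∣↥[b/c-x] {m} x b c d₀ ↧x≡cd₀ m⊥d₀ mc∣d₀b-x =
    ℤ.coprime-divisor (+ m) (+ d₀) (↥ δ) m⊥d₀ (Signed.∣⇒∣ᵤ m∣d₀↥δ)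
    where
    δ = + b / c -ℚ x
    C = + c
    D = + d₀
    ↧x≡ : ↧ x ≡ C * D
    ↧x≡ = trans (cong +_ ↧x≡cd₀) (pos-* c d₀)
    cross : (D * + b - ↥ x) * ↧ δ ≡ D * ↥ δ * C
    cross = sym (*-cancelˡ-≡ C _ _ (begin
      C * (D * ↥ δ * C)                 ≡⟨ gather C D (↥ δ) ⟩
      ↥ δ * (C * (C * D))               ≡⟨ cong (λ z → ↥ δ * (C * z)) ↧x≡ ⟨
      ↥ δ * (C * ↧ x)                   ≡⟨ ↥[i/n-x]-cross (+ b) c x ⟩
      (+ b * ↧ x - ↥ x * C) * ↧ δ       ≡⟨ cong (λ z → (+ b * z - ↥ x * C) * ↧ δ) ↧x≡ ⟩
      (+ b * (C * D) - ↥ x * C) * ↧ δ   ≡⟨ factor C D (+ b) (↥ x) (↧ δ) ⟩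
      C * ((D * + b - ↥ x) * ↧ δ)       ∎))
      where
      gather : ∀ C D R → C * (D * R * C) ≡ R * (C * (C * D))
      gather = solve-∀
      factor : ∀ C D B X Y → (B * (C * D) - X * C) * Y ≡ C * ((D * B - X) * Y)
      factor = solve-∀
    m∣d₀↥δ : + m Signed.∣ D * ↥ δ
    m∣d₀↥δ = Signed.*-cancelʳ-∣ C
      (subst₂ Signed._∣_ (pos-* m c) cross (Signed.∣m⇒∣m*n (↧ δ) mc∣d₀b-x))

module Blocks where
  open PrimePowers using (prime∤1; prime∣prime⇒≡; prime^-coprime; prime∤^; m∣m^n)
  open AvoidingFactorials
  open LinearCongruences using (linear-congruence)
  open import Data.Nat using (suc; _+_; _*_; _∸_; _^_; _≤_; _<_; _≤?_; z<s; >-nonZero; >-nonZero⁻¹)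
  open import Data.Nat.Properties
    using (+-comm; *-comm; *-suc; *-identityˡ; *-identityʳ; m*n≢0; m^n≢0; +-monoˡ-≤; *-monoʳ-≤;
           ^-monoˡ-<; ^-monoʳ-≤; <⇒≱; ≰⇒>; module ≤-Reasoning)
  open import Data.Nat.Divisibility using (_∣_; _∣0; ∣-trans; ∣⇒≤; ∣m+n∣m⇒∣n; m∣m*n)
  open import Data.Nat.Coprimality as Coprime using (Coprime; coprime-divisor)
  open import Data.Nat.Primality using (prime⇒nonZero; euclidsLemma)
  open import Data.Integer as ℤ using (+_)
  open import Data.Integer.Properties using (pos-*)
  import Data.Integer.Divisibility.Signed as Signed
  open import Data.Integer.Tactic.RingSolver using (solve-∀)
  open import Data.Product using (∃)
  open import Data.Sum using ([_,_]′)
  open import Function using (_∘_)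
  open import Relation.Nullary using (¬_; Dec; yes; no)
  open import Relation.Binary.PropositionalEquality using (_≡_; _≢_; refl; sym; cong; subst; module ≡-Reasoning)

  private variable
    p q a c : ℕ

  record Block (q a : ℕ) : Set where
    constructor block
    field
      j b h   : ℕ
      a≡q^j*b : a ≡ q ^ j * b
      M∣b∸1   : factorialAvoiding q h ∣ b ∸ 1
      0<b     : 0 < b
      b≤h*M   : b ≤ h * factorialAvoiding q h

  Block-nonZero : Prime q → Block q a → NonZero a
  Block-nonZero {q} q-prime (block j b h refl _ 0<b _) =
    m*n≢0 (q ^ j) b {{m^n≢0 q j {{prime⇒nonZero q-prime}}}} {{>-nonZero 0<b}}

  power-Block : ∀ q e → Block q (q ^ e)
  power-Block q e = block e 1 1 (sym (*-identityʳ (q ^ e))) (_ ∣0) z<s 1≤1*M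
    where
    1≤1*M : 1 ≤ 1 * factorialAvoiding q 1
    1≤1*M = subst (1 ≤_) (sym (*-identityˡ _)) (>-nonZero⁻¹ _ {{factorialAvoiding≢0 q 1}})

  Block-residue : Prime q → ¬ q ∣ c → ∀ L t →
                  ∃ λ b → Block q b × + (q ^ L) Signed.∣ + c ℤ.* + b ℤ.- t
  Block-residue {q} {c} q-prime q∤c L t = from-solution (linear-congruence Q Mc⊥Q (t ℤ.- + c))
    where
    instance
      _ = m^n≢0 q L {{prime⇒nonZero q-prime}}
      _ = factorialAvoiding≢0 q (q ^ L)
    Q = q ^ L
    M = factorialAvoiding q Q
    Mc⊥Q : Coprime (M * c) Q
    Mc⊥Q = Coprime.sym (prime^-coprime q-prime q∤Mc L)
      where q∤Mc = [ prime∤factorialAvoiding q-prime Q , q∤c ]′ ∘ euclidsLemma M c q-prime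
    from-solution : (∃ λ y → y < Q × + Q Signed.∣ + (M * c) ℤ.* + y ℤ.- (t ℤ.- + c)) →
                    ∃ λ b → Block q b × + Q Signed.∣ + c ℤ.* + b ℤ.- t
    from-solution (y , y<Q , Q∣Mcy-[t-c]) =
      suc (M * y) , block 0 (suc (M * y)) Q (sym (*-identityˡ _)) (m∣m*n y) z<s b≤Q*M ,
      subst (+ Q Signed.∣_) (sym cb-t≡Mcy-[t-c]) Q∣Mcy-[t-c]
      where
      b≤Q*M : suc (M * y) ≤ Q * M
      b≤Q*M = begin
        suc (M * y)  ≤⟨ +-monoˡ-≤ (M * y) (>-nonZero⁻¹ M) ⟩
        M + M * y    ≡⟨ *-suc M y ⟨
        M * suc y    ≤⟨ *-monoʳ-≤ M y<Q ⟩
        M * Q        ≡⟨ *-comm M Q ⟩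
        Q * M        ∎
        where open ≤-Reasoning
      cb-t≡Mcy-[t-c] : + c ℤ.* + suc (M * y) ℤ.- t ≡ + (M * c) ℤ.* + y ℤ.- (t ℤ.- + c)
      cb-t≡Mcy-[t-c] = begin
        + c ℤ.* (ℤ.1ℤ ℤ.+ + (M * y)) ℤ.- t     ≡⟨ cong (λ z → + c ℤ.* (ℤ.1ℤ ℤ.+ z) ℤ.- t) (pos-* M y) ⟩
        + c ℤ.* (ℤ.1ℤ ℤ.+ + M ℤ.* + y) ℤ.- t   ≡⟨ expand (+ c) (+ M) (+ y) t ⟩
        + M ℤ.* + c ℤ.* + y ℤ.- (t ℤ.- + c)    ≡⟨ cong (λ z → z ℤ.* + y ℤ.- (t ℤ.- + c)) (pos-* M c) ⟨
        + (M * c) ℤ.* + y ℤ.- (t ℤ.- + c)      ∎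
        where
        open ≡-Reasoning
        expand : ∀ C M Y T → C ℤ.* (ℤ.1ℤ ℤ.+ M ℤ.* Y) ℤ.- T ≡ M ℤ.* C ℤ.* Y ℤ.- (T ℤ.- C)
        expand = solve-∀

  Block-p^p∤ : Prime p → Prime q → p ≢ q → Block q a → ¬ p ^ p ∣ a
  Block-p^p∤ {p} {q} p-prime q-prime p≢q (block j (suc b′) h refl M∣b′ z<s b≤h*M) p^p∣a =
    cofactor-p^p∤ (p ≤? h) (coprime-divisor (prime^-coprime p-prime (prime∤^ p-prime p∤q j) p) p^p∣a)
    where
    instance _ = prime⇒nonZero p-prime
    b = suc b′
    p∤q : ¬ p ∣ q
    p∤q = p≢q ∘ prime∣prime⇒≡ p-prime q-prime
    q∤p : ¬ q ∣ p
    q∤p = p≢q ∘ sym ∘ prime∣prime⇒≡ q-prime p-prime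
    cofactor-p^p∤ : Dec (p ≤ h) → ¬ p ^ p ∣ b
    cofactor-p^p∤ (yes p≤h) p^p∣b =
      prime∤1 p-prime (∣m+n∣m⇒∣n (subst (p ∣_) (+-comm 1 b′) p∣b) p∣b′)
      where
      p∣b  = ∣-trans (m∣m^n p p) p^p∣b
      p∣b′ = ∣-trans (∣factorialAvoiding (>-nonZero⁻¹ p) p≤h q∤p) M∣b′
    cofactor-p^p∤ (no p≰h) p^p∣b = <⇒≱ b<p^p (∣⇒≤ p^p∣b)
      where
      h<p = ≰⇒> p≰h
      b<p^p : b < p ^ p
      b<p^p = begin-strict
        b                          ≤⟨ b≤h*M ⟩
        h * factorialAvoiding q h  ≤⟨ *-monoʳ-≤ h (factorialAvoiding≤^ q h) ⟩
        h ^ suc h                  <⟨ ^-monoˡ-< (suc h) h<p ⟩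
        p ^ suc h                  ≤⟨ ^-monoʳ-≤ p h<p ⟩
        p ^ p                      ∎
        where open ≤-Reasoning

module Construction where
  open PrimePowers using (prime-power-split; prime^-coprime; m∣m^n)
  open Numerators using (prime∣↥⇒∤↧; coprime∧∣↥[a/n]⇒∣a; congruence⇒∣↥[b/c-x])
  open Blocks using (Block; Block-nonZero; power-Block; Block-residue; Block-p^p∤)
  open import Data.Nat using (_+_; _^_; _≟_)
  open import Data.Nat.Properties using (^-distribˡ-+-*; m^n≢0)
  open import Data.Nat.Divisibility using (∣-trans)
  open import Data.Nat.Primality using (prime⇒nonZero)
  open import Data.Integer as ℤ using (+_)
  open import Data.Integer.Divisibility using (_∣_)
  import Data.Integer.Divisibility.Signed as Signed
  open import Data.Rational using (↥_; ↧ₙ_; _/_; 0ℚ)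
  open import Data.Rational.Properties using (+-identityʳ)
  open import Data.Product using (∃)
  open import Relation.Nullary using (yes; no; contradiction)
  open import Relation.Unary using (_⊆_)
  open import Relation.Binary.PropositionalEquality using (refl; subst)

  A[_] : (ℕ → Set) → ℕ → Set
  A[ P ] a = ∃ λ q → P q × Block q a

  private variable
    P : ℕ → Set
    p : ℕ

  A-nonZero : P ⊆ Prime → ∀ a → A[ P ] a → NonZero a
  A-nonZero P⊆Prime a (q , Pq , a∈) = Block-nonZero (P⊆Prime Pq) a∈

  ∈P⇒A-dense : P ⊆ Prime → P p → DenseInQp p (RatioSet A[ P ])
  ∈P⇒A-dense {P} {p} P⊆Prime Pp x k =
    let p-prime                = P⊆Prime Pp
        (e , d₀ , ↧x≡ , p∤d₀) = prime-power-split p-prime (↧ₙ x)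
        (b , b∈ , d₀b≡x)       = Block-residue p-prime p∤d₀ (k + e) (↥ x)
        p^e≢0                  = m^n≢0 p e {{prime⇒nonZero p-prime}}
        instance _ = p^e≢0
    in  + b / p ^ e ,
        (b , p ^ e , (p , Pp , b∈) , (p , Pp , power-Block p e) , p^e≢0 , refl) ,
        congruence⇒∣↥[b/c-x] x b (p ^ e) d₀ ↧x≡ (prime^-coprime p-prime p∤d₀ k)
          (subst (λ m → + m Signed.∣ + d₀ ℤ.* + b ℤ.- ↥ x) (^-distribˡ-+-* p k e) d₀b≡x)

  A-dense⇒∈P : P ⊆ Prime → Prime p → DenseInQp p (RatioSet A[ P ]) → P p
  A-dense⇒∈P {P} {p} P⊆Prime p-prime dense with dense 0ℚ p
  ... | s , (a , a′ , (q , Pq , a∈) , _ , a′≢0 , refl) , p^p∣↥[s-0] with p ≟ q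
  ...   | yes refl = Pq
  ...   | no  p≢q  = contradiction p^p∣a (Block-p^p∤ p-prime (P⊆Prime Pq) p≢q a∈)
    where
    instance _ = prime⇒nonZero p-prime
    p^p∣↥s : + (p ^ p) ∣ ↥ s
    p^p∣↥s = subst (λ t → + (p ^ p) ∣ ↥ t) (+-identityʳ s) p^p∣↥[s-0]
    p∤↧s = prime∣↥⇒∤↧ {r = s} p-prime (∣-trans (m∣m^n p p) p^p∣↥s)
    p^p∣a = coprime∧∣↥[a/n]⇒∣a a a′ {{a′≢0}} (prime^-coprime p-prime p∤↧s p) p^p∣↥s

open Construction using (A[_]; A-nonZero; ∈P⇒A-dense; A-dense⇒∈P)

theorem3p1 : (P : ℕ → Set) → (∀ p → P p → Prime p) →
    Σ (ℕ → Set) λ A → (∀ a → A a → NonZero a) ×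
      (∀ p → Prime p → (DenseInQp p (RatioSet A) ⇔ P p))
theorem3p1 P P-primes =
  A[ P ] , A-nonZero P⊆Prime , λ p p-prime → mk⇔ (A-dense⇒∈P P⊆Prime p-prime) (∈P⇒A-dense P⊆Prime)
  where
  P⊆Prime = λ {p} → P-primes p
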